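{- For every $k,p\in\mathbb N$ there exists a deterministic MSO transduction $\mathcal E_{k,p}$ whose input vocabulary is the vocabulary of width-$k$ clique decompositions extended with $p$ unary predicates (coloring the leaves), and whose output vocabulary is the vocabulary of width-$(k\cdot p)$ clique decompositions, such that: on an input decomposition $t$ whose leaves are partitioned into $(V_1,\dots,V_p)$ by the unary predicates, the output of $\mathcal E_{k,p}$ is a clique decomposition $t'$ of the same graph in which, in the result of $t'$, every vertex from $V_i$ has color $i$, for all $i\in[p]$.
   Context: Width-$k$ clique decompositions are rooted trees without sibling order, labelled by operations on $k$-colored graphs (graphs with each vertex colored from $[k]$): Recolor$_\phi$ for $\phi\colon[k]\to[k]$ (unary; recolors $i$ to $\phi(i)$), Join$_S$ for $S$ a family of nonempty subsets of $[k]$ of size $\le2$ (disjoint union of a finite family of inputs plus, for each $\{i,j\}\in S$, all edges between vertices of colors $i$ and $j$ coming from different inputs), Constant$_i$ (leaves; one vertex of color $i$). The result is obtained by evaluation; its vertices are the leaves. Encoding: universe the nodes, binary child relation, unary predicates for the labels. An MSO transduction is a composition of filtering, universe restriction, MSO interpretation, copying and coloring steps; it is deterministic if it uses no coloring step. "The same graph" means the results coincide as uncolored graphs on the same leaves (vertices). -}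

module Defs where

open import Data.Nat using (ℕ; zero; suc; _*_)
open import Data.Fin using (Fin; zero; suc; toℕ; remQuot; _≟_)
open import Data.Fin.Properties using ()
open import Data.Bool using (Bool; true; false; _∧_; _∨_; not; if_then_else_)
open import Data.List using (List; []; _∷_; length; filterᵇ; concatMap)
open import Data.Bool.ListAction using (any)
open import Data.List.Base using (allFin)
import Data.List as L
open import Data.Vec using (Vec; []; _∷_; lookup)
import Data.Vec as V
open import Data.Maybe using (Maybe; just; nothing; _>>=_)
open import Data.Product using (Σ; Σ-syntax; ∃; _×_; _,_; proj₁; proj₂)
open import Data.Sum using (_⊎_; inj₁; inj₂)
open import Relation.Binary.PropositionalEquality using (_≡_; _≢_)
open import Relation.Nullary using (¬_; does)
open import Function using (_∘_; id)

record Voc : Set₁ where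
  field
    Sym : Set
    ar  : Sym → ℕ
open Voc public

record Str (Σv : Voc) : Set where
  field
    size : ℕ
    rel  : (R : Sym Σv) → Vec (Fin size) (ar Σv R) → Bool
open Str public

-- MSO formulas (de Bruijn): m first-order variables, s set variables

data Fm (Σv : Voc) (m s : ℕ) : Set where
  atom : (R : Sym Σv) → Vec (Fin m) (ar Σv R) → Fm Σv m s
  eq   : Fin m → Fin m → Fm Σv m s
  mem  : Fin m → Fin s → Fm Σv m s
  neg  : Fm Σv m s → Fm Σv m s
  and  : Fm Σv m s → Fm Σv m s → Fm Σv m s
  or   : Fm Σv m s → Fm Σv m s → Fm Σv m s
  ex1  : Fm Σv (suc m) s → Fm Σv m s
  ex2  : Fm Σv m (suc s) → Fm Σv m s

allSets : (n : ℕ) → List (Fin n → Bool)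
allSets zero = (λ ()) ∷ []
allSets (suc n) = concatMap (λ f → ext false f ∷ ext true f ∷ []) (allSets n)
  where
  ext : Bool → (Fin n → Bool) → Fin (suc n) → Bool
  ext b f zero = b
  ext b f (suc i) = f i

extend : {A : Set} {m : ℕ} → A → (Fin m → A) → Fin (suc m) → A
extend a ρ zero = a
extend a ρ (suc i) = ρ i

⟦_⟧ : ∀ {Σv m s} → Fm Σv m s → (A : Str Σv) →
      (Fin m → Fin (size A)) → (Fin s → Fin (size A) → Bool) → Bool
⟦ atom R xs ⟧ A ρ σ = rel A R (V.map ρ xs)
⟦ eq x y ⟧ A ρ σ = does (ρ x ≟ ρ y)
⟦ mem x X ⟧ A ρ σ = σ X (ρ x)
⟦ neg φ ⟧ A ρ σ = not (⟦ φ ⟧ A ρ σ)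
⟦ and φ ψ ⟧ A ρ σ = ⟦ φ ⟧ A ρ σ ∧ ⟦ ψ ⟧ A ρ σ
⟦ or φ ψ ⟧ A ρ σ = ⟦ φ ⟧ A ρ σ ∨ ⟦ ψ ⟧ A ρ σ
⟦ ex1 φ ⟧ A ρ σ = any (λ a → ⟦ φ ⟧ A (extend a ρ) σ) (allFin (size A))
⟦ ex2 φ ⟧ A ρ σ = any (λ X → ⟦ φ ⟧ A ρ (extend X σ)) (allSets (size A))

-- Deterministic MSO transductions (no coloring step)

data CopySym (c : ℕ) : Set where
  copyR : CopySym c            -- binary: y is a copy of x (same origin)
  layer : Fin c → CopySym c

copyVoc : Voc → ℕ → Voc
copyVoc Σv c = record { Sym = Sym Σv ⊎ CopySym c ; ar = a }
  where
  a : Sym Σv ⊎ CopySym c → ℕ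
  a (inj₁ R) = ar Σv R
  a (inj₂ copyR) = 2
  a (inj₂ (layer _)) = 1

data Atom : Voc → Voc → Set₁ where
  filtering   : ∀ {Σv} → Fm Σv 0 0 → Atom Σv Σv
  restriction : ∀ {Σv} → Fm Σv 1 0 → Atom Σv Σv
  interpret   : ∀ {Σv Γ} → ((R : Sym Γ) → Fm Σv (ar Γ R) 0) → Atom Σv Γ
  copying     : ∀ {Σv} (c : ℕ) → Atom Σv (copyVoc Σv c)

data Transduction : Voc → Voc → Set₁ where
  done : ∀ {Σv} → Transduction Σv Σv
  step : ∀ {Σv Γ Δ} → Atom Σv Γ → Transduction Γ Δ → Transduction Σv Δ

-- Output structure together with the origin map (output element ↦ input element)
Out : ∀ {Σv} → Str Σv → Voc → Set
Out A Γ = Σ[ B ∈ Str Γ ] (Fin (size B) → Fin (size A))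

noSet : ∀ {n} → Fin 0 → Fin n → Bool
noSet ()

allSame : ∀ {c r} → Vec (Fin c) r → Bool
allSame [] = true
allSame (x ∷ xs) = V.foldr _ (λ y b → does (x ≟ y) ∧ b) true xs

runAtom : ∀ {Σv Γ} → Atom Σv Γ → (A : Str Σv) → Maybe (Out A Γ)
runAtom (filtering φ) A =
  if ⟦ φ ⟧ A (λ ()) noSet then just (A , id) else nothing
runAtom {Σv} (restriction φ) A = just (B , lookupL)
  where
  xs : List (Fin (size A))
  xs = filterᵇ (λ a → ⟦ φ ⟧ A (λ _ → a) noSet) (allFin (size A))
  lookupL : Fin (length xs) → Fin (size A)
  lookupL = L.lookup xs
  B : Str Σv
  B = record { size = length xs ; rel = λ R ts → rel A R (V.map lookupL ts) }
runAtom {Σv} {Γ} (interpret φs) A =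
  just (record { size = size A ; rel = λ R ts → ⟦ φs R ⟧ A (lookup ts) noSet } , id)
runAtom {Σv} (copying c) A = just (B , org)
  where
  n = size A
  org : Fin (c * n) → Fin n
  org e = proj₂ (remQuot {c} n e)
  lay : Fin (c * n) → Fin c
  lay e = proj₁ (remQuot {c} n e)
  r : (R : Sym (copyVoc Σv c)) → Vec (Fin (c * n)) (ar (copyVoc Σv c) R) → Bool
  r (inj₁ R) ts = allSame (V.map lay ts) ∧ rel A R (V.map org ts)
  r (inj₂ copyR) (x ∷ y ∷ []) = does (org x ≟ org y)
  r (inj₂ (layer j)) (x ∷ []) = does (lay x ≟ j)
  B : Str (copyVoc Σv c)
  B = record { size = c * n ; rel = r }

run : ∀ {Σv Γ} → Transduction Σv Γ → (A : Str Σv) → Maybe (Out A Γ)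
run done A = just (A , id)
run (step a T) A = runAtom a A >>= λ { (B , o) →
                   run T B >>= λ { (C , o') → just (C , o ∘ o') } }

-- Recolor φ : φ encoded as the vector (φ(0),…,φ(k-1));
-- Join S   : S encoded as a k×k Boolean matrix, S[i][j] = true iff {i,j} ∈ S
--            (a valid decomposition only uses symmetric matrices, see IsDecomp;
--             the diagonal S[i][i] encodes the singleton {i});
-- Constant i.
data Label (k : ℕ) : Set where
  recolor  : Vec (Fin k) k → Label k
  join     : Vec (Vec Bool k) k → Label k
  constant : Fin k → Label k

data CSym (k : ℕ) : Set where
  child : CSym k          -- child x y : y is a child of x
  lab   : Label k → CSym k

cliqueVoc : ℕ → Voc
cliqueVoc k = record { Sym = CSym k ; ar = a }
  where
  a : CSym k → ℕ
  a child = 2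
  a (lab _) = 1

inS : ∀ {k} → Vec (Vec Bool k) k → Fin k → Fin k → Bool
inS S i j = lookup (lookup S i) j

module _ {k : ℕ} (t : Str (cliqueVoc k)) where
  private n = size t

  Child : Fin n → Fin n → Set
  Child x y = rel t child (x ∷ y ∷ []) ≡ true

  Has : Label k → Fin n → Set
  Has ℓ x = rel t (lab ℓ) (x ∷ []) ≡ true

  IsRoot : Fin n → Set
  IsRoot r = ∀ y → ¬ Child y r

  IsRootedTree : Set
  IsRootedTree =
    (Σ[ r ∈ Fin n ] IsRoot r × (∀ x → x ≢ r → Σ[ y ∈ Fin n ] Child y x))
    × (∀ x y z → Child y x → Child z x → y ≡ z)
    × (Σ[ d ∈ (Fin n → ℕ) ] (∀ x y → Child x y → d y ≡ suc (d x)))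

  Arity-ok : Label k → Fin n → Set
  Arity-ok (constant i) x = ∀ y → ¬ Child x y
  Arity-ok (recolor φ) x = Σ[ y ∈ Fin n ] Child x y × (∀ z → Child x z → z ≡ y)
  Arity-ok (join S) x = ∀ i j → inS S i j ≡ inS S j i

  IsDecomp : Set
  IsDecomp = IsRootedTree ×
    (∀ x → Σ[ ℓ ∈ Label k ] Has ℓ x × (∀ ℓ' → Has ℓ' x → ℓ' ≡ ℓ) × Arity-ok ℓ x)

  IsLeaf : Fin n → Set
  IsLeaf x = Σ[ i ∈ Fin k ] Has (constant i) x

  -- ColAt x v c : leaf v has color c in the result of the subtree rooted at x
  data ColAt : Fin n → Fin n → Fin k → Set where
    cLeaf : ∀ {v i} → Has (constant i) v → ColAt v v i
    cRec  : ∀ {x y v c φ} → Has (recolor φ) x → Child x y → ColAt y v c →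
            ColAt x v (lookup φ c)
    cJoin : ∀ {x y v c S} → Has (join S) x → Child x y → ColAt y v c →
            ColAt x v c

  -- edge of the resulting graph (vertices = leaves)
  Edge : Fin n → Fin n → Set
  Edge u v = Σ[ x ∈ Fin n ] Σ[ S ∈ Vec (Vec Bool k) k ] Σ[ y ∈ Fin n ] Σ[ y' ∈ Fin n ]
             Σ[ c ∈ Fin k ] Σ[ d ∈ Fin k ]
             Has (join S) x × Child x y × Child x y' × y ≢ y' ×
             ColAt y u c × ColAt y' v d × inS S c d ≡ true

  ResColor : Fin n → Fin k → Set
  ResColor v c = Σ[ r ∈ Fin n ] IsRoot r × ColAt r v c

inVoc : ℕ → ℕ → Voc
inVoc k p = record { Sym = CSym k ⊎ Fin p ; ar = a }
  where
  a : CSym k ⊎ Fin p → ℕ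
  a (inj₁ R) = ar (cliqueVoc k) R
  a (inj₂ _) = 1

module _ {k p : ℕ} (A : Str (inVoc k p)) where
  reduct : Str (cliqueVoc k)
  reduct = record { size = size A ; rel = λ R ts → rel A (inj₁ R) ts }

  InPart : Fin p → Fin (size A) → Set
  InPart i x = rel A (inj₂ i) (x ∷ []) ≡ true

  LeafPartition : Set
  LeafPartition = (∀ i x → InPart i x → IsLeaf reduct x)
                × (∀ x → IsLeaf reduct x → Σ[ i ∈ Fin p ] InPart i x)
                × (∀ i j x → InPart i x → InPart j x → i ≡ j)

Good : ∀ {k p} (A : Str (inVoc k p)) → Out A (cliqueVoc (k * p)) → Set
Good {k} {p} A (B , org) =
  IsDecomp B
  × (∀ u → IsLeaf B u → IsLeaf (reduct A) (org u))
  × (∀ u v → IsLeaf B u → IsLeaf B v → org u ≡ org v → u ≡ v)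
  × (∀ a → IsLeaf (reduct A) a → Σ[ u ∈ Fin (size B) ] IsLeaf B u × org u ≡ a)
  × (∀ u v → IsLeaf B u → IsLeaf B v →
       (Edge B u v → Edge (reduct A) (org u) (org v))
     × (Edge (reduct A) (org u) (org v) → Edge B u v))
  × (∀ u i → IsLeaf B u → InPart A i (org u) →
       Σ[ c ∈ Fin (k * p) ] ResColor B u c × toℕ c ≡ toℕ i)

module Submission where

-- Read a colour of Fin (k * p) as a pair (c , i) of a
-- colour c of t and a part index i (via combine/remQuot).  Relabel t so that a
-- leaf of colour c lying in V_i gets the pair (c , i), while every Recolor_φ and
-- Join_S acts on first components only: the relabelled tree evaluates to the
-- same graph and its leaves carry their part index as second component.  Above
-- its root we put a Recolor collapsing every pair (c , i) to (0 , i), whose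
-- number is i.
--
-- The transduction copies the input three times.  Layer `body` is the
-- relabelled copy of t; the copy of the root r in layer `top` is the new root
-- carrying the collapsing recolouring; the copy of r in layer `hub` is a Join_∅
-- between the two.  All other nodes of the layers top and hub are childless
-- Join_∅ nodes (empty graphs) hung below the hub, so nothing needs deleting.

open import Defs
open import Data.Nat using (ℕ; zero; suc; _*_; _+_)
open import Data.Nat.Properties using (*-zeroʳ; suc-injective; 1+n≢0)
open import Data.Fin using (Fin; zero; suc; toℕ; remQuot; combine; _≟_)
open import Data.Fin.Properties using (¬Fin0; remQuot-combine; combine-remQuot; combine-injectiveʳ; toℕ-↑ˡ)
open import Data.Bool using (Bool; true; false; _∧_; _∨_; not; if_then_else_; T)
import Data.Bool.Properties as Bool
open import Data.Bool.ListAction using (any)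
open import Data.List using (List)
open import Data.List.Base using (allFin)
open import Data.List.Membership.Propositional using (_∈_; lose)
open import Data.List.Membership.Propositional.Properties using (∈-allFin)
open import Data.List.Relation.Unary.Any using (satisfied)
open import Data.List.Relation.Unary.Any.Properties using (any⁺; any⁻)
open import Data.Vec using (Vec; []; _∷_; lookup; tabulate; replicate)
open import Data.Vec.Properties using (lookup∘tabulate; tabulate∘lookup; tabulate-cong; lookup-replicate; ≡-dec)
open import Data.Empty using (⊥; ⊥-elim)
open import Data.Maybe using (just)
open import Data.Sum using (inj₁; inj₂)
open import Data.Product using (Σ-syntax; _×_; _,_; proj₁; proj₂)
open import Function.Bundles using (Equivalence)
open import Relation.Binary.Definitions using (DecidableEquality)
open import Relation.Binary.PropositionalEquality
  using (_≡_; _≢_; refl; sym; trans; cong; cong₂; subst; subst₂; module ≡-Reasoning)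
open import Relation.Nullary using (¬_; yes; no; does)
open import Relation.Nullary.Decidable using (dec-true; dec-false)

any-witness : ∀ {X : Set} (f : X → Bool) {xs : List X} {x : X} →
              x ∈ xs → f x ≡ true → any f xs ≡ true
any-witness f x∈xs fx =
  Equivalence.to Bool.T-≡ (any⁺ f (lose x∈xs (Equivalence.from Bool.T-≡ fx)))

any-none : ∀ {X : Set} (f : X → Bool) (xs : List X) →
           (∀ x → f x ≡ false) → any f xs ≡ false
any-none f xs none with any f xs in holds
... | false = refl
... | true with satisfied (any⁻ f xs (Equivalence.from Bool.T-≡ holds))
...   | x , fx = ⊥-elim (subst T (none x) fx)

-- Used twice: for colour pairs
-- (m , n) = (k , p), and for the elements of an m-fold copy of a structure
-- of size n, which is exactly how the copying step numbers them.
module Pairing (m n : ℕ) where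
  fst : Fin (m * n) → Fin m
  fst e = proj₁ (remQuot {m} n e)

  snd : Fin (m * n) → Fin n
  snd e = proj₂ (remQuot {m} n e)

  fst-combine : (c : Fin m) (i : Fin n) → fst (combine c i) ≡ c
  fst-combine c i = cong proj₁ (remQuot-combine c i)

  snd-combine : (c : Fin m) (i : Fin n) → snd (combine c i) ≡ i
  snd-combine c i = cong proj₂ (remQuot-combine c i)

  data View : Fin (m * n) → Set where
    pair : (c : Fin m) (i : Fin n) → View (combine c i)

  view : ∀ e → View e
  view e = subst View (combine-remQuot {m} n e) (pair (fst e) (snd e))

module ColourPairs (k p : ℕ) where
  open Pairing k p renaming (fst to first; snd to second;
                             fst-combine to first-combine; snd-combine to second-combine)
    using () public

  liftRecolor : Vec (Fin k) k → Vec (Fin (k * p)) (k * p)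
  liftRecolor φ = tabulate (λ e → combine (lookup φ (first e)) (second e))

  lookup-liftRecolor : ∀ φ c i → lookup (liftRecolor φ) (combine c i) ≡ combine (lookup φ c) i
  lookup-liftRecolor φ c i = begin
    lookup (liftRecolor φ) (combine c i)
      ≡⟨ lookup∘tabulate _ (combine c i) ⟩
    combine (lookup φ (first (combine c i))) (second (combine c i))
      ≡⟨ cong₂ (λ c' i' → combine (lookup φ c') i') (first-combine c i) (second-combine c i) ⟩
    combine (lookup φ c) i ∎
    where open ≡-Reasoning

  liftJoin : Vec (Vec Bool k) k → Vec (Vec Bool (k * p)) (k * p)
  liftJoin S = tabulate (λ e → tabulate (λ e' → inS S (first e) (first e')))

  inS-liftJoin : ∀ S e e' → inS (liftJoin S) e e' ≡ inS S (first e) (first e')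
  inS-liftJoin S e e' rewrite lookup∘tabulate (λ e → tabulate (λ e' → inS S (first e) (first e'))) e =
    lookup∘tabulate (λ e' → inS S (first e) (first e')) e'

  projRecolor : Fin p → Vec (Fin (k * p)) (k * p) → Vec (Fin k) k
  projRecolor i₀ ψ = tabulate (λ c → first (lookup ψ (combine c i₀)))

  projRecolor-lift : ∀ i₀ φ → projRecolor i₀ (liftRecolor φ) ≡ φ
  projRecolor-lift i₀ φ =
    trans (tabulate-cong (λ c → trans (cong first (lookup-liftRecolor φ c i₀)) (first-combine _ i₀)))
          (tabulate∘lookup φ)

  projJoin : Fin p → Vec (Vec Bool (k * p)) (k * p) → Vec (Vec Bool k) k
  projJoin i₀ S = tabulate (λ c → tabulate (λ d → inS S (combine c i₀) (combine d i₀)))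

  projJoin-lift : ∀ i₀ S → projJoin i₀ (liftJoin S) ≡ S
  projJoin-lift i₀ S = trans (tabulate-cong row) (tabulate∘lookup S)
    where
    entry : ∀ c d → inS (liftJoin S) (combine c i₀) (combine d i₀) ≡ inS S c d
    entry c d = trans (inS-liftJoin S _ _) (cong₂ (inS S) (first-combine c i₀) (first-combine d i₀))
    row : ∀ c → tabulate (λ d → inS (liftJoin S) (combine c i₀) (combine d i₀)) ≡ lookup S c
    row c = trans (tabulate-cong (entry c)) (tabulate∘lookup (lookup S c))

  -- the final recolouring (c , i) ↦ (0 , i); the number of (0 , i) is that of i
  -- (zeroLike c is the colour 0, which exists as Fin k is inhabited by c)
  zeroLike : Fin k → Fin k
  zeroLike zero = zero
  zeroLike (suc _) = zero

  collapse : Vec (Fin (k * p)) (k * p)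
  collapse = tabulate (λ e → combine (zeroLike (first e)) (second e))

  toℕ-collapse : ∀ e → toℕ (lookup collapse e) ≡ toℕ (second e)
  toℕ-collapse e rewrite lookup∘tabulate (λ e → combine (zeroLike (first e)) (second e)) e =
    toℕ-combine-zero (first e)
    where
    toℕ-combine-zero : ∀ c → toℕ (combine (zeroLike c) (second e)) ≡ toℕ (second e)
    toℕ-combine-zero zero = toℕ-↑ˡ (second e) _
    toℕ-combine-zero (suc _) = toℕ-↑ˡ (second e) _

  emptyJoin : Vec (Vec Bool (k * p)) (k * p)
  emptyJoin = replicate (k * p) (replicate (k * p) false)

  inS-emptyJoin : ∀ e e' → inS emptyJoin e e' ≡ false
  inS-emptyJoin e e' rewrite lookup-replicate e (replicate (k * p) false) = lookup-replicate e' false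

  emptyJoin-edgeless : ∀ e e' → ¬ (inS emptyJoin e e' ≡ true)
  emptyJoin-edgeless e e' holds with trans (sym (inS-emptyJoin e e')) holds
  ... | ()

  Symmetric : ∀ {m} → Vec (Vec Bool m) m → Set
  Symmetric S = ∀ e e' → inS S e e' ≡ inS S e' e

  liftJoin-symmetric : ∀ S → Symmetric S → Symmetric (liftJoin S)
  liftJoin-symmetric S sym-S e e' =
    trans (inS-liftJoin S e e') (trans (sym-S (first e) (first e')) (sym (inS-liftJoin S e' e)))

  emptyJoin-symmetric : Symmetric emptyJoin
  emptyJoin-symmetric e e' = trans (inS-emptyJoin e e') (sym (inS-emptyJoin e' e))

pattern body = zero
pattern top  = suc zero
pattern hub  = suc (suc zero)

-- The transduction: copy three times, then interpret the output decomposition.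
-- i₀ is any part index; it is used to read a label of width k * p back as a
-- label of t.
module Construction (k p : ℕ) (i₀ : Fin p) where
  open ColourPairs k p

  K : ℕ
  K = k * p

  Copy : Voc
  Copy = copyVoc (inVoc k p) 3

  inLayer : ∀ {m} → Fin 3 → Fin m → Fm Copy m 0
  inLayer l x = atom (inj₂ (layer l)) (x ∷ [])

  childAtom : ∀ {m} → Fin m → Fin m → Fm Copy m 0
  childAtom x y = atom (inj₁ (inj₁ child)) (x ∷ y ∷ [])

  sameOrigin : ∀ {m} → Fin m → Fin m → Fm Copy m 0
  sameOrigin x y = atom (inj₂ copyR) (x ∷ y ∷ [])

  -- x has no parent (within its own layer): x is a copy of the root
  isRootF : ∀ {m} → Fin m → Fm Copy m 0
  isRootF x = neg (ex1 (childAtom zero (suc x)))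

  constF : ∀ {m} → Bool → Fin m → Fm Copy m 0
  constF true x = eq x x
  constF false x = neg (eq x x)

  _≟ᶜ_ : DecidableEquality (Vec (Fin K) K)
  _≟ᶜ_ = ≡-dec _≟_

  _≟ˢ_ : DecidableEquality (Vec (Vec Bool K) K)
  _≟ˢ_ = ≡-dec (≡-dec Bool._≟_)

  -- ℓ is the lift of the label of the origin of x (in the body layer)
  liftedLabelF : Label K → Fm Copy 1 0
  liftedLabelF (recolor ψ) =
    if does (ψ ≟ᶜ liftRecolor (projRecolor i₀ ψ))
    then atom (inj₁ (inj₁ (lab (recolor (projRecolor i₀ ψ))))) (zero ∷ [])
    else constF false zero
  liftedLabelF (join S) =
    if does (S ≟ˢ liftJoin (projJoin i₀ S))
    then atom (inj₁ (inj₁ (lab (join (projJoin i₀ S))))) (zero ∷ [])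
    else constF false zero
  liftedLabelF (constant e) =
    and (atom (inj₁ (inj₁ (lab (constant (first e))))) (zero ∷ []))
        (atom (inj₁ (inj₂ (second e))) (zero ∷ []))

  isCollapse : Label K → Bool
  isCollapse (recolor ψ) = does (ψ ≟ᶜ collapse)
  isCollapse _ = false

  isEmptyJoin : Label K → Bool
  isEmptyJoin (join S) = does (S ≟ˢ emptyJoin)
  isEmptyJoin _ = false

  isCollapse-sound : ∀ ℓ → isCollapse ℓ ≡ true → ℓ ≡ recolor collapse
  isCollapse-sound (recolor ψ) h with ψ ≟ᶜ collapse
  isCollapse-sound (recolor ψ) h | yes refl = refl
  isCollapse-sound (recolor ψ) () | no _

  isEmptyJoin-sound : ∀ ℓ → isEmptyJoin ℓ ≡ true → ℓ ≡ join emptyJoin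
  isEmptyJoin-sound (join S) h with S ≟ˢ emptyJoin
  isEmptyJoin-sound (join S) h | yes refl = refl
  isEmptyJoin-sound (join S) () | no _

  -- y is a child of x: inside the body as in t; the top root above the hub
  -- root; below the hub root the body root and every non-root node of the
  -- layers top and hub
  childF : Fm Copy 2 0
  childF =
    or (and (inLayer body x) (childAtom x y))
       (or (and (inLayer top x) (and (inLayer hub y) (and (sameOrigin x y) (isRootF x))))
           (and (inLayer hub x) (and (isRootF x)
                (or (and (inLayer body y) (sameOrigin x y))
                    (and (neg (inLayer body y)) (neg (isRootF y)))))))
    where
    x y : Fin 2
    x = zero
    y = suc zero

  -- body nodes carry lifted labels, the top root the collapse, all others Join_∅
  labelF : Label K → Fm Copy 1 0
  labelF ℓ =
    or (and (inLayer body zero) (liftedLabelF ℓ))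
       (or (and (inLayer top zero) (and (isRootF zero) (constF (isCollapse ℓ) zero)))
           (and (or (inLayer hub zero) (and (inLayer top zero) (neg (isRootF zero))))
                (constF (isEmptyJoin ℓ) zero)))

  interpretation : (R : CSym K) → Fm Copy (ar (cliqueVoc K) R) 0
  interpretation child = childF
  interpretation (lab ℓ) = labelF ℓ

  transduction : Transduction (inVoc k p) (cliqueVoc K)
  transduction = step (copying 3) (step (interpret interpretation) done)

  module Output (A : Str (inVoc k p)) (dec : IsDecomp (reduct A)) (part : LeafPartition A) where
    n : ℕ
    n = size A

    t : Str (cliqueVoc k)
    t = reduct A

    open Pairing 3 n renaming (fst to layerOf; snd to originOf;
                               fst-combine to layerOf-combine; snd-combine to originOf-combine)

    -- the run never fails; its steps are computed by normalisation
    copyRun : Σ[ o ∈ Out A Copy ] runAtom (copying 3) A ≡ just o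
    copyRun = _ , refl

    copied : Str Copy
    copied = proj₁ (proj₁ copyRun)

    fullRun : Σ[ o ∈ Out A (cliqueVoc K) ] run transduction A ≡ just o
    fullRun = _ , refl

    B : Str (cliqueVoc K)
    B = proj₁ (proj₁ fullRun)

    node : Fin 3 → Fin n → Fin (3 * n)
    node = combine

    node-injective : ∀ l a a' → node l a ≡ node l a' → a ≡ a'
    node-injective l a a' = combine-injectiveʳ l a l a'

    r : Fin n
    r = proj₁ (proj₁ (proj₁ dec))

    r-isRoot : IsRoot t r
    r-isRoot = proj₁ (proj₂ (proj₁ (proj₁ dec)))

    parent : ∀ a → a ≢ r → Σ[ b ∈ Fin n ] Child t b a
    parent = proj₂ (proj₂ (proj₁ (proj₁ dec)))

    parent-unique : ∀ a b b' → Child t b a → Child t b' a → b ≡ b'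
    parent-unique = proj₁ (proj₂ (proj₁ dec))

    depth : Fin n → ℕ
    depth = proj₁ (proj₂ (proj₂ (proj₁ dec)))

    depth-child : ∀ a b → Child t a b → depth b ≡ suc (depth a)
    depth-child = proj₂ (proj₂ (proj₂ (proj₁ dec)))

    t-label-unique : ∀ {ℓ ℓ' a} → Has t ℓ a → Has t ℓ' a → ℓ ≡ ℓ'
    t-label-unique {ℓ} {ℓ'} {a} h h' = trans (unique ℓ h) (sym (unique ℓ' h'))
      where
      unique : ∀ ℓ'' → Has t ℓ'' a → ℓ'' ≡ proj₁ (proj₂ dec a)
      unique = proj₁ (proj₂ (proj₂ (proj₂ dec a)))

    leaf-part : ∀ a → IsLeaf t a → Σ[ i ∈ Fin p ] InPart A i a
    leaf-part = proj₁ (proj₂ part)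

    part-unique : ∀ i j a → InPart A i a → InPart A j a → i ≡ j
    part-unique = proj₂ (proj₂ part)

    atRoot : Fin n → Bool
    atRoot a = does (a ≟ r)

    childA : Fin n → Fin n → Bool
    childA a b = rel A (inj₁ child) (a ∷ b ∷ [])

    isRootF-value : ∀ {m} (x : Fin m) (ρ : Fin m → Fin (3 * n)) →
                    ⟦ isRootF x ⟧ copied ρ noSet ≡ atRoot (originOf (ρ x))
    isRootF-value x ρ with originOf (ρ x) ≟ r
    ... | yes o≡r = cong not (any-none _ (allFin (3 * n)) noParent)
      where
      noParent : ∀ z → ((does (layerOf z ≟ layerOf (ρ x)) ∧ true) ∧ childA (originOf z) (originOf (ρ x))) ≡ false
      noParent z with childA (originOf z) (originOf (ρ x)) in isChild
      ... | true = ⊥-elim (r-isRoot (originOf z) (subst (λ a → childA (originOf z) a ≡ true) o≡r isChild))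
      ... | false = Bool.∧-zeroʳ _
    ... | no o≢r with parent (originOf (ρ x)) o≢r
    ...   | b , b-parent = cong not (any-witness _ (∈-allFin z) isParent)
      where
      z : Fin (3 * n)
      z = node (layerOf (ρ x)) b
      isParent : ((does (layerOf z ≟ layerOf (ρ x)) ∧ true) ∧ childA (originOf z) (originOf (ρ x))) ≡ true
      isParent rewrite layerOf-combine (layerOf (ρ x)) b | originOf-combine (layerOf (ρ x)) b
                     | dec-true (layerOf (ρ x) ≟ layerOf (ρ x)) refl = b-parent

    childTest : Bool → Bool → Fin 3 × Fin n → Fin 3 × Fin n → Bool
    childTest isRootX isRootY (l , a) (l' , b) =
      (does (l ≟ body) ∧ ((does (l ≟ l') ∧ true) ∧ childA a b)) ∨
      ((does (l ≟ top) ∧ (does (l' ≟ hub) ∧ (does (a ≟ b) ∧ isRootX))) ∨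
       (does (l ≟ hub) ∧ (isRootX ∧ ((does (l' ≟ body) ∧ does (a ≟ b)) ∨
                                      (not (does (l' ≟ body)) ∧ not isRootY)))))

    childValue : Fin 3 × Fin n → Fin 3 × Fin n → Bool
    childValue (l , a) (l' , b) = childTest (atRoot a) (atRoot b) (l , a) (l' , b)

    child-value : ∀ x y → rel B child (x ∷ y ∷ []) ≡ childValue (remQuot n x) (remQuot n y)
    child-value x y = cong₂ (λ isRootX isRootY → childTest isRootX isRootY (remQuot n x) (remQuot n y))
                            (isRootF-value zero ρ) (isRootF-value (suc zero) ρ)
      where
      ρ : Fin 2 → Fin (3 * n)
      ρ = lookup (x ∷ y ∷ [])

    child-at : ∀ l a l' b → rel B child (node l a ∷ node l' b ∷ []) ≡ childValue (l , a) (l' , b)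
    child-at l a l' b = trans (child-value _ _) (cong₂ childValue (remQuot-combine l a) (remQuot-combine l' b))

    data NewChild : Fin 3 → Fin n → Fin 3 → Fin n → Set where
      bodyChild   : ∀ {a b} → Child t a b → NewChild body a body b
      topHub      : NewChild top r hub r
      hubBody     : NewChild hub r body r
      hubSpareTop : ∀ {b} → b ≢ r → NewChild hub r top b
      hubSpareHub : ∀ {b} → b ≢ r → NewChild hub r hub b

    childValue-sound : ∀ l a l' b → childValue (l , a) (l' , b) ≡ true → NewChild l a l' b
    childValue-sound body a body b h = bodyChild (trans (sym (Bool.∨-identityʳ _)) h)
    childValue-sound body a top b ()
    childValue-sound body a hub b ()
    childValue-sound top a body b ()
    childValue-sound top a top b ()
    childValue-sound top a hub b h with a ≟ b | a ≟ r
    childValue-sound top a hub .a h | yes refl | yes refl = topHub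
    childValue-sound top a hub b () | yes refl | no _
    childValue-sound top a hub b () | no _ | _
    childValue-sound hub a body b h with a ≟ b | a ≟ r
    childValue-sound hub a body .a h | yes refl | yes refl = hubBody
    childValue-sound hub a body b () | yes refl | no _
    childValue-sound hub a body b () | no _ | yes refl
    childValue-sound hub a body b () | no _ | no _
    childValue-sound hub a top b h with a ≟ r | b ≟ r
    childValue-sound hub a top b h | yes refl | no b≢r = hubSpareTop b≢r
    childValue-sound hub a top b () | yes refl | yes _
    childValue-sound hub a top b () | no _ | _
    childValue-sound hub a hub b h with a ≟ r | b ≟ r
    childValue-sound hub a hub b h | yes refl | no b≢r = hubSpareHub b≢r
    childValue-sound hub a hub b () | yes refl | yes _
    childValue-sound hub a hub b () | no _ | _

    childValue-complete : ∀ {l a l' b} → NewChild l a l' b → childValue (l , a) (l' , b) ≡ true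
    childValue-complete (bodyChild a-b) rewrite a-b = refl
    childValue-complete topHub rewrite dec-true (r ≟ r) refl = refl
    childValue-complete hubBody rewrite dec-true (r ≟ r) refl = refl
    childValue-complete (hubSpareTop {b} b≢r) rewrite dec-true (r ≟ r) refl | dec-false (b ≟ r) b≢r = refl
    childValue-complete (hubSpareHub {b} b≢r) rewrite dec-true (r ≟ r) refl | dec-false (b ≟ r) b≢r = refl

    child-sound : ∀ {l a l' b} → Child B (node l a) (node l' b) → NewChild l a l' b
    child-sound {l} {a} {l'} {b} h = childValue-sound l a l' b (trans (sym (child-at l a l' b)) h)

    child-complete : ∀ {l a l' b} → NewChild l a l' b → Child B (node l a) (node l' b)
    child-complete {l} {a} {l'} {b} c = trans (child-at l a l' b) (childValue-complete c)

    newRoot : Fin (3 * n)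
    newRoot = node top r

    newRoot-isRoot : IsRoot B newRoot
    newRoot-isRoot y h with view y
    ... | pair l a with child-sound {l} {a} {top} {r} h
    ...   | hubSpareTop r≢r = r≢r refl

    newParent : ∀ x → x ≢ newRoot → Σ[ y ∈ Fin (3 * n) ] Child B y x
    newParent x x≢root with view x
    newParent x x≢root | pair body a with a ≟ r
    ... | yes refl = node hub r , child-complete hubBody
    ... | no a≢r = node body (proj₁ (parent a a≢r)) , child-complete (bodyChild (proj₂ (parent a a≢r)))
    newParent x x≢root | pair top a with a ≟ r
    ... | yes refl = ⊥-elim (x≢root refl)
    ... | no a≢r = node hub r , child-complete (hubSpareTop a≢r)
    newParent x x≢root | pair hub a with a ≟ r
    ... | yes refl = node top r , child-complete topHub
    ... | no a≢r = node hub r , child-complete (hubSpareHub a≢r)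

    newChild-sameParent : ∀ {l a l' a' l'' b} → NewChild l a l'' b → NewChild l' a' l'' b →
                          node l a ≡ node l' a'
    newChild-sameParent (bodyChild c) (bodyChild c') = cong (node body) (parent-unique _ _ _ c c')
    newChild-sameParent (bodyChild c) hubBody = ⊥-elim (r-isRoot _ c)
    newChild-sameParent hubBody (bodyChild c') = ⊥-elim (r-isRoot _ c')
    newChild-sameParent hubBody hubBody = refl
    newChild-sameParent topHub topHub = refl
    newChild-sameParent topHub (hubSpareHub r≢r) = ⊥-elim (r≢r refl)
    newChild-sameParent (hubSpareHub r≢r) topHub = ⊥-elim (r≢r refl)
    newChild-sameParent (hubSpareHub _) (hubSpareHub _) = refl
    newChild-sameParent (hubSpareTop _) (hubSpareTop _) = refl

    newParent-unique : ∀ x y y' → Child B y x → Child B y' x → y ≡ y'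
    newParent-unique x y y' h h' with view x | view y | view y'
    ... | pair l a | pair l' b | pair l'' b' =
      newChild-sameParent (child-sound {l'} {b} {l} {a} h) (child-sound {l''} {b'} {l} {a} h')

    newDepth : Fin 3 → Fin n → ℕ
    newDepth body a = 2 + depth a
    newDepth top a = if atRoot a then depth r else 2 + depth r
    newDepth hub a = if atRoot a then 1 + depth r else 2 + depth r

    newDepth-child : ∀ {l a l' b} → NewChild l a l' b → newDepth l' b ≡ suc (newDepth l a)
    newDepth-child (bodyChild c) = cong (2 +_) (depth-child _ _ c)
    newDepth-child topHub rewrite dec-true (r ≟ r) refl = refl
    newDepth-child hubBody rewrite dec-true (r ≟ r) refl = refl
    newDepth-child (hubSpareTop {b} b≢r) rewrite dec-true (r ≟ r) refl | dec-false (b ≟ r) b≢r = refl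
    newDepth-child (hubSpareHub {b} b≢r) rewrite dec-true (r ≟ r) refl | dec-false (b ≟ r) b≢r = refl

    depthB : Fin (3 * n) → ℕ
    depthB x = newDepth (layerOf x) (originOf x)

    depthB-at : ∀ l a → depthB (node l a) ≡ newDepth l a
    depthB-at l a = cong₂ newDepth (layerOf-combine l a) (originOf-combine l a)

    depthB-child : ∀ x y → Child B x y → depthB y ≡ suc (depthB x)
    depthB-child x y h with view x | view y
    ... | pair l a | pair l' b =
      trans (depthB-at l' b) (trans (newDepth-child (child-sound {l} {a} {l'} {b} h)) (cong suc (sym (depthB-at l a))))

    output-tree : IsRootedTree B
    output-tree = (newRoot , newRoot-isRoot , newParent) , newParent-unique , (depthB , depthB-child)

    liftedValue : Label K → Fin n → Bool
    liftedValue (recolor ψ) a =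
      does (ψ ≟ᶜ liftRecolor (projRecolor i₀ ψ)) ∧ rel A (inj₁ (lab (recolor (projRecolor i₀ ψ)))) (a ∷ [])
    liftedValue (join S) a =
      does (S ≟ˢ liftJoin (projJoin i₀ S)) ∧ rel A (inj₁ (lab (join (projJoin i₀ S)))) (a ∷ [])
    liftedValue (constant e) a =
      rel A (inj₁ (lab (constant (first e)))) (a ∷ []) ∧ rel A (inj₂ (second e)) (a ∷ [])

    constF-value : ∀ b x → ⟦ constF b zero ⟧ copied (lookup (x ∷ [])) noSet ≡ b
    constF-value true x = dec-true (x ≟ x) refl
    constF-value false x = cong not (dec-true (x ≟ x) refl)

    liftedLabel-value : ∀ ℓ x → ⟦ liftedLabelF ℓ ⟧ copied (lookup (x ∷ [])) noSet ≡ liftedValue ℓ (originOf x)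
    liftedLabel-value (recolor ψ) x with ψ ≟ᶜ liftRecolor (projRecolor i₀ ψ)
    ... | yes _ = refl
    ... | no _ = constF-value false x
    liftedLabel-value (join S) x with S ≟ˢ liftJoin (projJoin i₀ S)
    ... | yes _ = refl
    ... | no _ = constF-value false x
    liftedLabel-value (constant e) x = refl

    labelTest : Bool → Bool → Bool → Bool → Fin 3 → Bool
    labelTest lifted isRootX collapsing empty l =
      (does (l ≟ body) ∧ lifted) ∨
      ((does (l ≟ top) ∧ (isRootX ∧ collapsing)) ∨
       ((does (l ≟ hub) ∨ (does (l ≟ top) ∧ not isRootX)) ∧ empty))

    labelValue : Label K → Fin 3 × Fin n → Bool
    labelValue ℓ (l , a) = labelTest (liftedValue ℓ a) (atRoot a) (isCollapse ℓ) (isEmptyJoin ℓ) l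

    label-value : ∀ ℓ x → rel B (lab ℓ) (x ∷ []) ≡ labelValue ℓ (remQuot n x)
    label-value ℓ x = begin
      rel B (lab ℓ) (x ∷ [])
        ≡⟨⟩
      labelTest (⟦ liftedLabelF ℓ ⟧ copied ρ noSet) (⟦ isRootF zero ⟧ copied ρ noSet)
                (⟦ constF (isCollapse ℓ) zero ⟧ copied ρ noSet) (⟦ constF (isEmptyJoin ℓ) zero ⟧ copied ρ noSet)
                (layerOf x)
        ≡⟨ cong₂ (λ collapsing empty → labelTest (⟦ liftedLabelF ℓ ⟧ copied ρ noSet)
                                                   (⟦ isRootF zero ⟧ copied ρ noSet) collapsing empty (layerOf x))
                 (constF-value (isCollapse ℓ) x) (constF-value (isEmptyJoin ℓ) x) ⟩
      labelTest (⟦ liftedLabelF ℓ ⟧ copied ρ noSet) (⟦ isRootF zero ⟧ copied ρ noSet)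
                (isCollapse ℓ) (isEmptyJoin ℓ) (layerOf x)
        ≡⟨ cong₂ (λ lifted isRootX → labelTest lifted isRootX (isCollapse ℓ) (isEmptyJoin ℓ) (layerOf x))
                 (liftedLabel-value ℓ x) (isRootF-value zero ρ) ⟩
      labelValue ℓ (remQuot n x) ∎
      where
      open ≡-Reasoning
      ρ : Fin 1 → Fin (3 * n)
      ρ = lookup (x ∷ [])

    label-at : ∀ ℓ l a → rel B (lab ℓ) (node l a ∷ []) ≡ labelValue ℓ (l , a)
    label-at ℓ l a = trans (label-value ℓ _) (cong (labelValue ℓ) (remQuot-combine l a))

    data NewLabel : Label K → Fin 3 → Fin n → Set where
      bodyRecolor : ∀ {φ a} → Has t (recolor φ) a → NewLabel (recolor (liftRecolor φ)) body a
      bodyJoin    : ∀ {S a} → Has t (join S) a → NewLabel (join (liftJoin S)) body a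
      bodyLeaf    : ∀ {c i a} → Has t (constant c) a → InPart A i a → NewLabel (constant (combine c i)) body a
      rootRecolor : NewLabel (recolor collapse) top r
      spareTop    : ∀ {a} → a ≢ r → NewLabel (join emptyJoin) top a
      hubJoin     : ∀ {a} → NewLabel (join emptyJoin) hub a

    liftedValue-sound : ∀ ℓ a → liftedValue ℓ a ≡ true → NewLabel ℓ body a
    liftedValue-sound (recolor ψ) a h with ψ ≟ᶜ liftRecolor (projRecolor i₀ ψ)
    ... | yes ψ-lifted = subst (λ ψ' → NewLabel (recolor ψ') body a) (sym ψ-lifted) (bodyRecolor h)
    liftedValue-sound (join S) a h with S ≟ˢ liftJoin (projJoin i₀ S)
    ... | yes S-lifted = subst (λ S' → NewLabel (join S') body a) (sym S-lifted) (bodyJoin h)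
    liftedValue-sound (constant e) a h =
      subst (λ e' → NewLabel (constant e') body a) (combine-remQuot {k} p e)
            (bodyLeaf (Bool.∧-conicalˡ _ _ h) (Bool.∧-conicalʳ _ _ h))

    labelValue-sound : ∀ ℓ l a → labelValue ℓ (l , a) ≡ true → NewLabel ℓ l a
    labelValue-sound ℓ body a h = liftedValue-sound ℓ a (trans (sym (Bool.∨-identityʳ _)) h)
    labelValue-sound ℓ top a h with a ≟ r
    ... | yes refl = subst (λ ℓ' → NewLabel ℓ' top r) (sym (isCollapse-sound ℓ (trans (sym (Bool.∨-identityʳ _)) h)))
                           rootRecolor
    ... | no a≢r = subst (λ ℓ' → NewLabel ℓ' top a) (sym (isEmptyJoin-sound ℓ h)) (spareTop a≢r)
    labelValue-sound ℓ hub a h = subst (λ ℓ' → NewLabel ℓ' hub a) (sym (isEmptyJoin-sound ℓ h)) hubJoin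

    liftedValue-complete : ∀ {ℓ a} → NewLabel ℓ body a → liftedValue ℓ a ≡ true
    liftedValue-complete (bodyRecolor {φ} h)
      rewrite projRecolor-lift i₀ φ | dec-true (liftRecolor φ ≟ᶜ liftRecolor φ) refl = h
    liftedValue-complete (bodyJoin {S} h)
      rewrite projJoin-lift i₀ S | dec-true (liftJoin S ≟ˢ liftJoin S) refl = h
    liftedValue-complete (bodyLeaf {c} {i} h inV)
      rewrite first-combine c i | second-combine c i | h | inV = refl

    labelValue-complete : ∀ {ℓ l a} → NewLabel ℓ l a → labelValue ℓ (l , a) ≡ true
    labelValue-complete nl@(bodyRecolor _) = cong (_∨ false) (liftedValue-complete nl)
    labelValue-complete nl@(bodyJoin _) = cong (_∨ false) (liftedValue-complete nl)
    labelValue-complete nl@(bodyLeaf _ _) = cong (_∨ false) (liftedValue-complete nl)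
    labelValue-complete rootRecolor rewrite dec-true (r ≟ r) refl | dec-true (collapse ≟ᶜ collapse) refl = refl
    labelValue-complete (spareTop {a} a≢r) rewrite dec-false (a ≟ r) a≢r | dec-true (emptyJoin ≟ˢ emptyJoin) refl = refl
    labelValue-complete hubJoin rewrite dec-true (emptyJoin ≟ˢ emptyJoin) refl = refl

    label-sound : ∀ {ℓ l a} → Has B ℓ (node l a) → NewLabel ℓ l a
    label-sound {ℓ} {l} {a} h = labelValue-sound ℓ l a (trans (sym (label-at ℓ l a)) h)

    label-complete : ∀ {ℓ l a} → NewLabel ℓ l a → Has B ℓ (node l a)
    label-complete {ℓ} {l} {a} nl = trans (label-at ℓ l a) (labelValue-complete nl)

    newLabel-unique : ∀ {ℓ ℓ' l a} → NewLabel ℓ l a → NewLabel ℓ' l a → ℓ ≡ ℓ'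
    newLabel-unique (bodyRecolor h) (bodyRecolor h') with t-label-unique h h'
    ... | refl = refl
    newLabel-unique (bodyRecolor h) (bodyJoin h') with t-label-unique h h'
    ... | ()
    newLabel-unique (bodyRecolor h) (bodyLeaf h' _) with t-label-unique h h'
    ... | ()
    newLabel-unique (bodyJoin h) (bodyRecolor h') with t-label-unique h h'
    ... | ()
    newLabel-unique (bodyJoin h) (bodyJoin h') with t-label-unique h h'
    ... | refl = refl
    newLabel-unique (bodyJoin h) (bodyLeaf h' _) with t-label-unique h h'
    ... | ()
    newLabel-unique (bodyLeaf h _) (bodyRecolor h') with t-label-unique h h'
    ... | ()
    newLabel-unique (bodyLeaf h _) (bodyJoin h') with t-label-unique h h'
    ... | ()
    newLabel-unique (bodyLeaf {c} {i} {a} h inV) (bodyLeaf {i = j} h' inV') with t-label-unique h h'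
    ... | refl = cong (λ i' → constant (combine c i')) (part-unique i j a inV inV')
    newLabel-unique rootRecolor rootRecolor = refl
    newLabel-unique rootRecolor (spareTop r≢r) = ⊥-elim (r≢r refl)
    newLabel-unique (spareTop r≢r) rootRecolor = ⊥-elim (r≢r refl)
    newLabel-unique (spareTop _) (spareTop _) = refl
    newLabel-unique hubJoin hubJoin = refl

    children-of-body : ∀ {a z} → Child B (node body a) z → Σ[ b ∈ Fin n ] z ≡ node body b × Child t a b
    children-of-body {a} {z} h with view z
    ... | pair l b with child-sound {body} {a} {l} {b} h
    ...   | bodyChild a-b = b , refl , a-b

    WellLabelled : Fin (3 * n) → Set
    WellLabelled x = Σ[ ℓ ∈ Label K ] Has B ℓ x × (∀ ℓ' → Has B ℓ' x → ℓ' ≡ ℓ) × Arity-ok B ℓ x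

    well-labelled-by : ∀ {ℓ l a} → NewLabel ℓ l a → Arity-ok B ℓ (node l a) → WellLabelled (node l a)
    well-labelled-by nl arity-ok =
      _ , label-complete nl , (λ ℓ' h → newLabel-unique (label-sound h) nl) , arity-ok

    body-well-labelled : ∀ a → WellLabelled (node body a)
    body-well-labelled a with proj₂ dec a
    ... | recolor φ , h , _ , (b , a-b , only-b) =
      well-labelled-by (bodyRecolor h) (node body b , child-complete (bodyChild a-b) , onlyChild)
      where
      onlyChild : ∀ z → Child B (node body a) z → z ≡ node body b
      onlyChild z hz with children-of-body hz
      ... | b' , refl , a-b' = cong (node body) (only-b b' a-b')
    ... | join S , h , _ , S-symmetric =
      well-labelled-by (bodyJoin h) (liftJoin-symmetric S S-symmetric)
    ... | constant c , h , _ , childless with leaf-part a (c , h)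
    ...   | i , inV = well-labelled-by (bodyLeaf h inV) noChild
      where
      noChild : ∀ z → ¬ Child B (node body a) z
      noChild z hz with children-of-body hz
      ... | b , _ , a-b = childless b a-b

    top-well-labelled : ∀ a → WellLabelled (node top a)
    top-well-labelled a with a ≟ r
    ... | yes refl = well-labelled-by rootRecolor (node hub r , child-complete topHub , onlyChild)
      where
      onlyChild : ∀ z → Child B (node top r) z → z ≡ node hub r
      onlyChild z hz with view z
      ... | pair l b with child-sound {top} {r} {l} {b} hz
      ...   | topHub = refl
    ... | no a≢r = well-labelled-by (spareTop a≢r) emptyJoin-symmetric

    output-well-labelled : ∀ x → WellLabelled x
    output-well-labelled x with view x
    ... | pair body a = body-well-labelled a
    ... | pair top a = top-well-labelled a
    ... | pair hub a = well-labelled-by hubJoin emptyJoin-symmetric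

    output-decomposition : IsDecomp B
    output-decomposition = output-tree , output-well-labelled

    leaf-in-body : ∀ x → IsLeaf B x → Σ[ a ∈ Fin n ] x ≡ node body a × IsLeaf t a
    leaf-in-body x (e , h) with view x
    ... | pair l a with label-sound {constant e} {l} {a} h
    ...   | bodyLeaf {c} h' _ = a , refl , (c , h')

    colour-lift : ∀ {a b c i} → ColAt t a b c → InPart A i b → ColAt B (node body a) (node body b) (combine c i)
    colour-lift (cLeaf h) inV = cLeaf (label-complete (bodyLeaf h inV))
    colour-lift {i = i} (cRec {c = c} {φ = φ} h a-y col) inV =
      subst (ColAt B _ _) (lookup-liftRecolor φ c i)
            (cRec {φ = liftRecolor φ} (label-complete (bodyRecolor h)) (child-complete (bodyChild a-y))
                  (colour-lift col inV))
    colour-lift (cJoin {S = S} h a-y col) inV =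
      cJoin {S = liftJoin S} (label-complete (bodyJoin h)) (child-complete (bodyChild a-y)) (colour-lift col inV)

    colour-project : ∀ {X U c'} → ColAt B X U c' → ∀ a → X ≡ node body a →
                     Σ[ b ∈ Fin n ] U ≡ node body b × Σ[ c ∈ Fin k ] ColAt t a b c ×
                       (∀ i → InPart A i b → c' ≡ combine c i)
    colour-project (cLeaf {i = e} h) a refl with label-sound {constant e} {body} {a} h
    ... | bodyLeaf {c} {i} h' inV =
      a , refl , c , cLeaf h' , λ j inV' → cong (combine c) (part-unique i j a inV inV')
    colour-project (cRec {φ = ψ} h x-y col) a refl with label-sound {recolor ψ} {body} {a} h | children-of-body x-y
    ... | bodyRecolor {φ} h' | b' , refl , a-b' with colour-project col b' refl
    ...   | b , U≡ , c , col' , pairs =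
      b , U≡ , lookup φ c , cRec h' a-b' col' ,
      λ i inV → trans (cong (lookup (liftRecolor φ)) (pairs i inV)) (lookup-liftRecolor φ c i)
    colour-project (cJoin {S = S'} h x-y col) a refl with label-sound {join S'} {body} {a} h | children-of-body x-y
    ... | bodyJoin h' | b' , refl , a-b' with colour-project col b' refl
    ...   | b , U≡ , c , col' , pairs = b , U≡ , c , cJoin h' a-b' col' , pairs

    colour-up : ∀ {x y v c} → Child t x y → ColAt t y v c → Σ[ c' ∈ Fin k ] ColAt t x v c'
    colour-up {x} x-y col with proj₂ dec x
    ... | recolor φ , h , _ = _ , cRec h x-y col
    ... | join S , h , _ = _ , cJoin h x-y col
    ... | constant _ , _ , _ , childless = ⊥-elim (childless _ x-y)

    colour-at-root : ∀ m y {v c} → depth y ≡ m → ColAt t y v c → Σ[ c' ∈ Fin k ] ColAt t r v c'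
    colour-at-root m y d col with y ≟ r
    ... | yes refl = _ , col
    ... | no y≢r with parent y y≢r
    ...   | x , x-y with m | colour-up x-y col
    ...     | zero | _ = ⊥-elim (1+n≢0 (trans (sym (depth-child x y x-y)) d))
    ...     | suc m | c' , col' = colour-at-root m x (suc-injective (trans (sym (depth-child x y x-y)) d)) col'

    edge-project : ∀ a b → IsLeaf t a → IsLeaf t b → Edge B (node body a) (node body b) → Edge t a b
    edge-project a b leaf-a leaf-b (x , S' , y , y' , c , d , hx , x-y , x-y' , y≢y' , col , col' , S'cd)
      with view x | view y | view y'
    ... | pair l z | pair ly w | pair ly' w' with label-sound {join S'} {l} {z} hx
    ...   | spareTop _ = ⊥-elim (emptyJoin-edgeless c d S'cd)
    ...   | hubJoin = ⊥-elim (emptyJoin-edgeless c d S'cd)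
    ...   | bodyJoin {S} h with child-sound {body} {z} {ly} {w} x-y | child-sound {body} {z} {ly'} {w'} x-y'
    ...     | bodyChild z-w | bodyChild z-w' with colour-project col w refl | colour-project col' w' refl
    ...       | a' , a≡ , ca , col-a , pairs-a | b' , b≡ , cb , col-b , pairs-b
      with node-injective body a a' a≡ | node-injective body b b' b≡
    ...         | refl | refl =
      z , S , w , w' , ca , cb , h , z-w , z-w' , (λ e → y≢y' (cong (node body) e)) , col-a , col-b , Scd
      where
      first-c : first c ≡ ca
      first-c = trans (cong first (pairs-a _ (proj₂ (leaf-part a leaf-a)))) (first-combine ca _)
      first-d : first d ≡ cb
      first-d = trans (cong first (pairs-b _ (proj₂ (leaf-part b leaf-b)))) (first-combine cb _)
      Scd : inS S ca cb ≡ true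
      Scd = trans (sym (cong₂ (inS S) first-c first-d)) (trans (sym (inS-liftJoin S c d)) S'cd)

    edge-lift : ∀ a b → IsLeaf t a → IsLeaf t b → Edge t a b → Edge B (node body a) (node body b)
    edge-lift a b leaf-a leaf-b (x , S , y , y' , c , d , h , x-y , x-y' , y≢y' , col , col' , Scd) =
      node body x , liftJoin S , node body y , node body y' , combine c i , combine d j ,
      label-complete (bodyJoin h) , child-complete (bodyChild x-y) , child-complete (bodyChild x-y') ,
      (λ e → y≢y' (node-injective body y y' e)) , colour-lift col inV-a , colour-lift col' inV-b ,
      trans (inS-liftJoin S _ _) (trans (cong₂ (inS S) (first-combine c i) (first-combine d j)) Scd)
      where
      i j : Fin p
      i = proj₁ (leaf-part a leaf-a)
      j = proj₁ (leaf-part b leaf-b)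
      inV-a : InPart A i a
      inV-a = proj₂ (leaf-part a leaf-a)
      inV-b : InPart A j b
      inV-b = proj₂ (leaf-part b leaf-b)

    -- A leaf in V_i ends up with colour (0 , i), whose number is i: its pair
    -- (c , i) at the body root is joined at the hub and collapsed at the top.
    final-colour : ∀ a i → IsLeaf t a → InPart A i a →
                   Σ[ c ∈ Fin K ] ResColor B (node body a) c × toℕ c ≡ toℕ i
    final-colour a i (c , h) inV with colour-at-root (depth a) a refl (cLeaf h)
    ... | c₀ , col =
      lookup collapse (combine c₀ i) , (newRoot , newRoot-isRoot , atTop) ,
      trans (toℕ-collapse _) (cong toℕ (second-combine c₀ i))
      where
      atHub : ColAt B (node hub r) (node body a) (combine c₀ i)
      atHub = cJoin {S = emptyJoin} (label-complete hubJoin) (child-complete hubBody) (colour-lift col inV)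
      atTop : ColAt B newRoot (node body a) (lookup collapse (combine c₀ i))
      atTop = cRec {φ = collapse} (label-complete rootRecolor) (child-complete topHub) atHub

    leaf-origin : ∀ u → IsLeaf B u → IsLeaf t (originOf u)
    leaf-origin u leaf-u with leaf-in-body u leaf-u
    ... | a , refl , leaf-a = subst (IsLeaf t) (sym (originOf-combine body a)) leaf-a

    origin-injective : ∀ u v → IsLeaf B u → IsLeaf B v → originOf u ≡ originOf v → u ≡ v
    origin-injective u v leaf-u leaf-v e with leaf-in-body u leaf-u | leaf-in-body v leaf-v
    ... | a , refl , _ | b , refl , _ =
      cong (node body) (trans (sym (originOf-combine body a)) (trans e (originOf-combine body b)))

    origin-surjective : ∀ a → IsLeaf t a → Σ[ u ∈ Fin (3 * n) ] IsLeaf B u × originOf u ≡ a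
    origin-surjective a (c , h) =
      node body a , (combine c i , label-complete (bodyLeaf h inV)) , originOf-combine body a
      where
      i : Fin p
      i = proj₁ (leaf-part a (c , h))
      inV : InPart A i a
      inV = proj₂ (leaf-part a (c , h))

    same-edges : ∀ u v → IsLeaf B u → IsLeaf B v →
                 (Edge B u v → Edge t (originOf u) (originOf v)) × (Edge t (originOf u) (originOf v) → Edge B u v)
    same-edges u v leaf-u leaf-v with leaf-in-body u leaf-u | leaf-in-body v leaf-v
    ... | a , refl , leaf-a | b , refl , leaf-b =
      (λ e → subst₂ (Edge t) (sym (originOf-combine body a)) (sym (originOf-combine body b))
                               (edge-project a b leaf-a leaf-b e)) ,
      (λ e → edge-lift a b leaf-a leaf-b (subst₂ (Edge t) (originOf-combine body a) (originOf-combine body b) e))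

    part-colours : ∀ u i → IsLeaf B u → InPart A i (originOf u) →
                   Σ[ c ∈ Fin K ] ResColor B u c × toℕ c ≡ toℕ i
    part-colours u i leaf-u inV with leaf-in-body u leaf-u
    ... | a , refl , leaf-a = final-colour a i leaf-a (subst (InPart A i) (originOf-combine body a) inV)

    output-good : Good A (proj₁ fullRun)
    output-good = output-decomposition , leaf-origin , origin-injective , origin-surjective , same-edges , part-colours

  correct : (A : Str (inVoc k p)) → IsDecomp (reduct A) → LeafPartition A →
            Σ[ o ∈ Out A (cliqueVoc K) ] (run transduction A ≡ just o × Good A o)
  correct A dec part = proj₁ fullRun , proj₂ fullRun , output-good
    where open Output A dec part

-- When p = 0 the partition forces t to have no leaves, and width k * 0 has no
-- colours: the output keeps the tree of t and labels every node by the unique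
-- join label (all matrices of size k * 0 are equal).
module NoParts (k : ℕ) where
  noColour : Fin (k * 0) → ⊥
  noColour e = ¬Fin0 (subst Fin (*-zeroʳ k) e)

  vectors-equal : ∀ {X : Set} (u v : Vec X (k * 0)) → u ≡ v
  vectors-equal u v = empty (*-zeroʳ k) u v
    where
    empty : ∀ {Y : Set} {m} → m ≡ 0 → (u v : Vec Y m) → u ≡ v
    empty refl [] [] = refl

  interpretation : (R : CSym (k * 0)) → Fm (inVoc k 0) (ar (cliqueVoc (k * 0)) R) 0
  interpretation child = atom (inj₁ child) (zero ∷ suc zero ∷ [])
  interpretation (lab (recolor _)) = neg (eq zero zero)
  interpretation (lab (join _)) = eq zero zero
  interpretation (lab (constant _)) = neg (eq zero zero)

  transduction : Transduction (inVoc k 0) (cliqueVoc (k * 0))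
  transduction = step (interpret interpretation) done

  module Output (A : Str (inVoc k 0)) where
    fullRun : Σ[ o ∈ Out A (cliqueVoc (k * 0)) ] run transduction A ≡ just o
    fullRun = _ , refl

    B : Str (cliqueVoc (k * 0))
    B = proj₁ (proj₁ fullRun)

    only-join : ∀ x S ℓ → Has B ℓ x → ℓ ≡ join S
    only-join x S (recolor _) h with x ≟ x
    only-join x S (recolor _) () | yes _
    only-join x S (recolor _) h | no x≢x = ⊥-elim (x≢x refl)
    only-join x S (join S') h = cong join (vectors-equal S' S)
    only-join x S (constant e) h = ⊥-elim (noColour e)

    well-labelled : ∀ x → Σ[ ℓ ∈ Label (k * 0) ] Has B ℓ x × (∀ ℓ' → Has B ℓ' x → ℓ' ≡ ℓ) × Arity-ok B ℓ x
    well-labelled x = join S , dec-true (x ≟ x) refl , (λ ℓ' → only-join x S ℓ') , (λ e → ⊥-elim (noColour e))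
      where
      S : Vec (Vec Bool (k * 0)) (k * 0)
      S = replicate (k * 0) (replicate (k * 0) false)

  correct : (A : Str (inVoc k 0)) → IsDecomp (reduct A) → LeafPartition A →
            Σ[ o ∈ Out A (cliqueVoc (k * 0)) ] (run transduction A ≡ just o × Good A o)
  correct A (tree , _) (_ , leaf-part , _) =
    proj₁ fullRun , proj₂ fullRun ,
    (tree , well-labelled) ,
    (λ u (e , _) → ⊥-elim (noColour e)) ,
    (λ u v (e , _) → ⊥-elim (noColour e)) ,
    (λ a leaf-a → ⊥-elim (¬Fin0 (proj₁ (leaf-part a leaf-a)))) ,
    (λ u v (e , _) → ⊥-elim (noColour e)) ,
    (λ u i → ⊥-elim (¬Fin0 i))
    where open Output A

mainTheorem10 : (k p : ℕ) →
    Σ[ E ∈ Transduction (inVoc k p) (cliqueVoc (k * p)) ]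
    ((A : Str (inVoc k p)) → IsDecomp (reduct A) → LeafPartition A →
    Σ[ r ∈ Out A (cliqueVoc (k * p)) ] (run E A ≡ just r × Good A r))
mainTheorem10 k zero = NoParts.transduction k , NoParts.correct k
mainTheorem10 k (suc p) = Construction.transduction k (suc p) zero , Construction.correct k (suc p) zero
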